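{- Let $k,n\in\mathbb{N}$ and $G=C_n(\{1,3,n-3,n-1\})$. If $n=10k$ or $n=14k$, then $\lambda_{(3,2,1)}(G)\leq 13$; moreover, the labeling obtained by repeating the pattern $0,3,6,9,12,1,4,7,10,13$ (for $n=10k$), respectively the pattern $0,3,6,9,12,1,4,7,10,13,2,5,8,11$ (for $n=14k$), is an $L(3,2,1)$-labeling of $G$.
   Context: For $n\ge 3$ and $S\subseteq\{1,\dots,n-1\}$ closed under $x\mapsto n-x$, the circulant $C_n(S)$ is the graph with vertex set $\{u_1,\dots,u_n\}$ in which $u_iu_j$ is an edge iff $|i-j|\in S$. An $L(3,2,1)$-labeling of a graph $G$ is a function $f:V(G)\to\mathbb{N}\cup\{0\}$ such that $|f(x)-f(y)|>3-\operatorname{dist}_G(x,y)$ for all distinct $x,y\in V(G)$. $\lambda_{(3,2,1)}(G)$ is the minimum, over all $L(3,2,1)$-labelings of $G$, of the difference between the largest and smallest label used. Repeating a pattern $p_1,\dots,p_m$ (where $m$ divides $n$) means the labeling $f(u_i)=p_{((i-1)\bmod m)+1}$ for $i=1,\dots,n$. -}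

module Defs where

open import Data.Nat using (ℕ; zero; suc; _+_; _*_; _∸_; _<_; _≤_; _⊔_; _⊓_; ∣_-_∣)
open import Data.Nat.DivMod using (_mod_)
open import Data.Fin using (Fin; toℕ)
open import Data.List using (List; map; foldr; allFin)
open import Data.Vec using (Vec; lookup; []; _∷_)
open import Data.Product using (Σ; _×_; _,_)
open import Data.Sum using (_⊎_)
open import Relation.Binary.PropositionalEquality using (_≡_; _≢_)
open import Relation.Nullary using (¬_)

Graph : ℕ → Set₁
Graph n = Fin n → Fin n → Set

-- Circulant C_n(S): vertices u_1..u_n (here indexed 0..n-1; differences unchanged),
-- u_i u_j an edge iff |i - j| ∈ S.
Circulant : (n : ℕ) → (S : ℕ → Set) → Graph n
Circulant n S i j = S ∣ toℕ i - toℕ j ∣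

S1-3 : ℕ → ℕ → Set
S1-3 n d = d ≡ 1 ⊎ d ≡ 3 ⊎ d ≡ n ∸ 3 ⊎ d ≡ n ∸ 1

data Walk {n : ℕ} (G : Graph n) : ℕ → Fin n → Fin n → Set where
  here : ∀ {x} → Walk G zero x x
  step : ∀ {m x y z} → G x y → Walk G m y z → Walk G (suc m) x z

IsDist : ∀ {n} → Graph n → Fin n → Fin n → ℕ → Set
IsDist G x y d = Walk G d x y × (∀ m → m < d → ¬ Walk G m x y)

-- L(3,2,1)-labeling: |f x - f y| > 3 - dist(x,y) for distinct x, y
-- (written as 3 < dist + |f x - f y| to stay in ℕ; vacuous if disconnected).
IsL321 : ∀ {n} → Graph n → (Fin n → ℕ) → Set
IsL321 {n} G f = ∀ (x y : Fin n) → x ≢ y → ∀ d → IsDist G x y d → 3 < d + ∣ f x - f y ∣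

maxLabel : ∀ {n} → (Fin n → ℕ) → ℕ
maxLabel {n} f = foldr _⊔_ 0 (map f (allFin n))

minLabel : ∀ {n} → (Fin n → ℕ) → ℕ
minLabel {n} f = foldr _⊓_ (maxLabel f) (map f (allFin n))

span : ∀ {n} → (Fin n → ℕ) → ℕ
span f = maxLabel f ∸ minLabel f

λ321≤ : ∀ {n} → Graph n → ℕ → Set
λ321≤ {n} G b = Σ (Fin n → ℕ) λ f → IsL321 G f × span f ≤ b

-- Repeating a pattern p_1..p_m (m = suc m'): f(u_i) = p_{((i-1) mod m)+1}.
repeatPattern : ∀ {m' n} → Vec ℕ (suc m') → Fin n → ℕ
repeatPattern {m'} p i = lookup p (toℕ i mod suc m')

pattern10 : Vec ℕ 10
pattern10 = 0 ∷ 3 ∷ 6 ∷ 9 ∷ 12 ∷ 1 ∷ 4 ∷ 7 ∷ 10 ∷ 13 ∷ []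

pattern14 : Vec ℕ 14
pattern14 = 0 ∷ 3 ∷ 6 ∷ 9 ∷ 12 ∷ 1 ∷ 4 ∷ 7 ∷ 10 ∷ 13 ∷ 2 ∷ 5 ∷ 8 ∷ 11 ∷ []

{-# OPTIONS --safe #-}
module Submission where

-- Every edge of C_n({1,3,n-3,n-1}) moves the index by ±1 or ±3 modulo n.  When m ∣ n these
-- moves descend to residues modulo m, on which a pattern repeated with period m depends.
-- Hence along a walk of length d ≤ 3 the label of the endpoint is determined by the residue
-- of the start and the d moves, so the L(3,2,1) condition becomes a finite check over residues
-- and move sequences, decided by computation.  The only short walk the check must exempt is a
-- move followed by its inverse, which returns to its start.

open import Defs
open import Data.Nat using (ℕ; zero; suc; _+_; _*_; _∸_; _<_; _≤_; _⊔_; ∣_-_∣; NonZero; z≤n; s≤s; _<?_; _≤?_)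
open import Data.Nat.Properties
  using (≤-trans; ≤-total; +-assoc; +-identityʳ; *-comm; +-∸-comm; m∸n≤m; m+[n∸m]≡n; m∸n+n≡m; m≤n⇒∣m-n∣≡n∸m; m≤n⇒∣n-m∣≡n∸m; ⊔-lub)
open import Data.Nat.DivMod using (_%_; _mod_; %-distribˡ-+; m%n%n≡m%n; [m+n]%n≡m%n; [m+kn]%n≡m%n; m<n⇒m%n≡m; m∣n⇒o%n%m≡o%m)
open import Data.Nat.Divisibility using (_∣_; divides; divides-refl; ∣⇒≤)
open import Data.Fin using (Fin; zero; suc; toℕ; opposite; _≟_)
open import Data.Fin.Properties using (all?; toℕ-injective; toℕ-fromℕ<; toℕ<n)
open import Data.Vec using (Vec; []; _∷_; lookup; map; sum)
open import Data.List using (allFin)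
open import Data.List.Properties using (foldr-preservesᵇ)
open import Data.List.Relation.Unary.All using (universal)
open import Data.List.Relation.Unary.All.Properties using (map⁺)
open import Data.Product using (Σ; _×_; _,_; ∃-syntax)
open import Data.Sum using (_⊎_; inj₁; inj₂; [_,_]′)
open import Data.Unit using (⊤; tt)
open import Data.Empty using (⊥; ⊥-elim)
open import Relation.Nullary using (Dec; yes; no; _⊎-dec_)
open import Relation.Nullary.Decidable using (map′; from-yes)
open import Relation.Binary.PropositionalEquality using (_≡_; _≢_; refl; sym; trans; cong; cong₂; subst; module ≡-Reasoning)

open ≡-Reasoning

∣m-n∣≡o⇒m+o≡n⊎n+o≡m : ∀ {m n o} → ∣ m - n ∣ ≡ o → m + o ≡ n ⊎ n + o ≡ m
∣m-n∣≡o⇒m+o≡n⊎n+o≡m {m} {n} refl with ≤-total m n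
... | inj₁ m≤n = inj₁ (trans (cong (m +_) (m≤n⇒∣m-n∣≡n∸m m≤n)) (m+[n∸m]≡n m≤n))
... | inj₂ n≤m = inj₂ (trans (cong (n +_) (m≤n⇒∣n-m∣≡n∸m n≤m)) (m+[n∸m]≡n n≤m))

+-%-cong : ∀ {a b c d} m .{{_ : NonZero m}} → a % m ≡ b % m → c % m ≡ d % m → (a + c) % m ≡ (b + d) % m
+-%-cong {a} {b} {c} {d} m a≡b c≡d = begin
  (a + c) % m         ≡⟨ %-distribˡ-+ a c m ⟩
  (a % m + c % m) % m ≡⟨ cong₂ (λ u v → (u + v) % m) a≡b c≡d ⟩
  (b % m + d % m) % m ≡⟨ %-distribˡ-+ b d m ⟨
  (b + d) % m         ∎

[n∸j]%m≡[m∸j]%m : ∀ {m n j} .{{_ : NonZero m}} .{{_ : NonZero n}} → m ∣ n → j ≤ m → (n ∸ j) % m ≡ (m ∸ j) % m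
[n∸j]%m≡[m∸j]%m {m} {j = j} (divides-refl (suc q)) j≤m = begin
  (m + q * m ∸ j) % m ≡⟨ cong (_% m) (+-∸-comm (q * m) j≤m) ⟩
  (m ∸ j + q * m) % m ≡⟨ [m+kn]%n≡m%n (m ∸ j) q m ⟩
  (m ∸ j) % m         ∎

all-vec? : ∀ {k d} {P : Vec (Fin k) d → Set} → (∀ ss → Dec (P ss)) → Dec (∀ ss → P ss)
all-vec? {d = zero}  P? = map′ (λ { p [] → p }) (λ p → p []) (P? [])
all-vec? {d = suc d} P? = map′ (λ { p (s ∷ ss) → p s ss }) (λ p s ss → p (s ∷ ss))
                               (all? λ s → all-vec? λ ss → P? (s ∷ ss))

-- Step s moves an index i to (i + shift n s) % n; opposite s is the inverse move.
Step : Set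
Step = Fin 4

shift : ℕ → Step → ℕ
shift n = lookup (1 ∷ 3 ∷ n ∸ 3 ∷ n ∸ 1 ∷ [])

displacement : ∀ {d} → ℕ → Vec Step d → ℕ
displacement n ss = sum (map (shift n) ss)

Cancels : ∀ {d} → Vec Step d → Set
Cancels []              = ⊤
Cancels (_ ∷ [])        = ⊥
Cancels (s ∷ t ∷ [])    = t ≡ opposite s
Cancels (_ ∷ _ ∷ _ ∷ _) = ⊥

cancels? : ∀ {d} (ss : Vec Step d) → Dec (Cancels ss)
cancels? []              = yes tt
cancels? (_ ∷ [])        = no λ ()
cancels? (s ∷ t ∷ [])    = t ≟ opposite s
cancels? (_ ∷ _ ∷ _ ∷ _) = no λ ()

Separated : ∀ {m'} → Vec ℕ (suc m') → Set
Separated {m'} p = ∀ (d : Fin 4) (r : Fin m) (ss : Vec Step (toℕ d)) →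
  Cancels ss ⊎ 3 < toℕ d + ∣ lookup p r - lookup p ((toℕ r + displacement m ss) mod m) ∣
  where
  m : ℕ
  m = suc m'

separated? : ∀ {m'} (p : Vec ℕ (suc m')) → Dec (Separated p)
separated? p = all? λ d → all? λ r → all-vec? λ ss → cancels? ss ⊎-dec (3 <? _)

shift+shift∘opposite≡n : ∀ {n} → 3 ≤ n → ∀ s → shift n s + shift n (opposite s) ≡ n
shift+shift∘opposite≡n 3≤n zero                   = m+[n∸m]≡n (≤-trans (s≤s z≤n) 3≤n)
shift+shift∘opposite≡n 3≤n (suc zero)             = m+[n∸m]≡n 3≤n
shift+shift∘opposite≡n 3≤n (suc (suc zero))       = m∸n+n≡m 3≤n
shift+shift∘opposite≡n 3≤n (suc (suc (suc zero))) = m∸n+n≡m (≤-trans (s≤s z≤n) 3≤n)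

connection⇒shift : ∀ n {c} → S1-3 n c → ∃[ s ] c ≡ shift n s
connection⇒shift n (inj₁ c≡1)              = zero , c≡1
connection⇒shift n (inj₂ (inj₁ c≡3))       = suc zero , c≡3
connection⇒shift n (inj₂ (inj₂ (inj₁ c≡))) = suc (suc zero) , c≡
connection⇒shift n (inj₂ (inj₂ (inj₂ c≡))) = suc (suc (suc zero)) , c≡

module _ {n} .{{_ : NonZero n}} (3≤n : 3 ≤ n) where

  adjacent⇒step : (x y : Fin n) → Circulant n (S1-3 n) x y → ∃[ s ] toℕ y ≡ (toℕ x + shift n s) % n
  adjacent⇒step x y adj with connection⇒shift n adj
  ... | s , ∣x-y∣≡c with ∣m-n∣≡o⇒m+o≡n⊎n+o≡m ∣x-y∣≡c
  ... | inj₁ x+c≡y = s , sym (trans (cong (_% n) x+c≡y) (m<n⇒m%n≡m (toℕ<n y)))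
  ... | inj₂ y+c≡x = opposite s , (begin
    toℕ y                                 ≡⟨ m<n⇒m%n≡m (toℕ<n y) ⟨
    toℕ y % n                             ≡⟨ [m+n]%n≡m%n (toℕ y) n ⟨
    (toℕ y + n) % n                       ≡⟨ cong (λ t → (toℕ y + t) % n) (shift+shift∘opposite≡n 3≤n s) ⟨
    (toℕ y + (c + c′)) % n                ≡⟨ cong (_% n) (+-assoc (toℕ y) c c′) ⟨
    (toℕ y + c + c′) % n                  ≡⟨ cong (λ t → (t + c′) % n) y+c≡x ⟩
    (toℕ x + c′) % n                      ∎)
    where
    c c′ : ℕ
    c = shift n s
    c′ = shift n (opposite s)

  walk⇒displacement : ∀ {d x y} → Walk (Circulant n (S1-3 n)) d x y →
                      Σ (Vec Step d) λ ss → toℕ y ≡ (toℕ x + displacement n ss) % n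
  walk⇒displacement {x = x} here = [] , sym (trans (cong (_% n) (+-identityʳ (toℕ x))) (m<n⇒m%n≡m (toℕ<n x)))
  walk⇒displacement {x = x} {y} (step {y = z} adj w) with adjacent⇒step x z adj | walk⇒displacement w
  ... | s , z≡ | ss , y≡ = s ∷ ss , (begin
    toℕ y                               ≡⟨ y≡ ⟩
    (toℕ z + D) % n                     ≡⟨ cong (λ t → (t + D) % n) z≡ ⟩
    ((toℕ x + shift n s) % n + D) % n   ≡⟨ +-%-cong n (m%n%n≡m%n (toℕ x + shift n s) n) refl ⟩
    (toℕ x + shift n s + D) % n         ≡⟨ cong (_% n) (+-assoc (toℕ x) (shift n s) D) ⟩
    (toℕ x + (shift n s + D)) % n       ∎)
    where
    D : ℕ
    D = displacement n ss

  cancels⇒displacement-returns : ∀ {d} {ss : Vec Step d} → Cancels ss → (x : Fin n) →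
                                 (toℕ x + displacement n ss) % n ≡ toℕ x
  cancels⇒displacement-returns {ss = []} _ x =
    trans (cong (_% n) (+-identityʳ (toℕ x))) (m<n⇒m%n≡m (toℕ<n x))
  cancels⇒displacement-returns {ss = s ∷ _ ∷ []} refl x = begin
    (toℕ x + (shift n s + (shift n (opposite s) + 0))) % n
      ≡⟨ cong (λ t → (toℕ x + (shift n s + t)) % n) (+-identityʳ _) ⟩
    (toℕ x + (shift n s + shift n (opposite s))) % n
      ≡⟨ cong (λ t → (toℕ x + t) % n) (shift+shift∘opposite≡n 3≤n s) ⟩
    (toℕ x + n) % n ≡⟨ [m+n]%n≡m%n (toℕ x) n ⟩
    toℕ x % n       ≡⟨ m<n⇒m%n≡m (toℕ<n x) ⟩
    toℕ x           ∎

module _ {m n} .{{_ : NonZero m}} .{{_ : NonZero n}} (3≤m : 3 ≤ m) (m∣n : m ∣ n) where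

  shift-%-reduce : ∀ s → shift n s % m ≡ shift m s % m
  shift-%-reduce zero                   = refl
  shift-%-reduce (suc zero)             = refl
  shift-%-reduce (suc (suc zero))       = [n∸j]%m≡[m∸j]%m m∣n 3≤m
  shift-%-reduce (suc (suc (suc zero))) = [n∸j]%m≡[m∸j]%m m∣n (≤-trans (s≤s z≤n) 3≤m)

  displacement-%-reduce : ∀ {d} (ss : Vec Step d) → displacement n ss % m ≡ displacement m ss % m
  displacement-%-reduce []       = refl
  displacement-%-reduce (s ∷ ss) = +-%-cong m (shift-%-reduce s) (displacement-%-reduce ss)

  endpoint-residue : ∀ {a b d} (ss : Vec Step d) → b ≡ (a + displacement n ss) % n →
                     b mod m ≡ (toℕ (a mod m) + displacement m ss) mod m
  endpoint-residue {a} {b} ss b≡ = toℕ-injective (begin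
    toℕ (b mod m)                              ≡⟨ toℕ-fromℕ< _ ⟩
    b % m                                      ≡⟨ cong (_% m) b≡ ⟩
    (a + displacement n ss) % n % m            ≡⟨ m∣n⇒o%n%m≡o%m m n _ m∣n ⟩
    (a + displacement n ss) % m                ≡⟨ +-%-cong m a%m≡ (displacement-%-reduce ss) ⟩
    (toℕ (a mod m) + displacement m ss) % m    ≡⟨ toℕ-fromℕ< _ ⟨
    toℕ ((toℕ (a mod m) + displacement m ss) mod m) ∎)
    where
    a%m≡ : a % m ≡ toℕ (a mod m) % m
    a%m≡ = trans (sym (m%n%n≡m%n a m)) (cong (_% m) (sym (toℕ-fromℕ< _)))

module _ {m'} (p : Vec ℕ (suc m')) (3≤m : 3 ≤ suc m') (sep : Separated p) where

  private
    m : ℕ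
    m = suc m'

  module _ {n} .{{_ : NonZero n}} (m∣n : m ∣ n) where

    private
      G : Graph n
      G = Circulant n (S1-3 n)

      3≤n : 3 ≤ n
      3≤n = ≤-trans 3≤m (∣⇒≤ m∣n)

    short-walk-separates : (d : Fin 4) {x y : Fin n} → x ≢ y → Walk G (toℕ d) x y →
                           3 < toℕ d + ∣ repeatPattern p x - repeatPattern p y ∣
    short-walk-separates d {x} {y} x≢y w with walk⇒displacement 3≤n w
    ... | ss , y≡ with sep d (toℕ x mod m) ss
    ... | inj₁ cancels = ⊥-elim (x≢y (toℕ-injective (sym (trans y≡ (cancels⇒displacement-returns 3≤n cancels x)))))
    ... | inj₂ far = subst (λ ℓ → 3 < toℕ d + ∣ repeatPattern p x - ℓ ∣)
                           (cong (lookup p) (sym (endpoint-residue 3≤m m∣n ss y≡))) far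

    walk-separates : ∀ {d x y} → x ≢ y → Walk G d x y → 3 < d + ∣ repeatPattern p x - repeatPattern p y ∣
    walk-separates {0}                       = short-walk-separates zero
    walk-separates {1}                       = short-walk-separates (suc zero)
    walk-separates {2}                       = short-walk-separates (suc (suc zero))
    walk-separates {3}                       = short-walk-separates (suc (suc (suc zero)))
    walk-separates {suc (suc (suc (suc _)))} _ _ = s≤s (s≤s (s≤s (s≤s z≤n)))

  repeatPattern-isL321 : ∀ {n} → m ∣ n → IsL321 (Circulant n (S1-3 n)) (repeatPattern p)
  repeatPattern-isL321 {suc _} m∣n x y x≢y d (w , _) = walk-separates m∣n x≢y w

span≤ : ∀ {n b} (f : Fin n → ℕ) → (∀ i → f i ≤ b) → span f ≤ b
span≤ {n} {b} f f≤b = ≤-trans (m∸n≤m (maxLabel f) (minLabel f)) maxLabel≤b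
  where
  maxLabel≤b : maxLabel f ≤ b
  maxLabel≤b = foldr-preservesᵇ {P = _≤ b} {f = _⊔_} ⊔-lub z≤n (map⁺ (universal f≤b (allFin n)))

repeatPattern-λ321≤ : ∀ {m' n b} (p : Vec ℕ (suc m')) → 3 ≤ suc m' → Separated p →
                      (∀ j → lookup p j ≤ b) → suc m' ∣ n → λ321≤ (Circulant n (S1-3 n)) b
repeatPattern-λ321≤ {n = n} p 3≤m sep p≤b m∣n =
  repeatPattern p , repeatPattern-isL321 p 3≤m sep m∣n , span≤ (repeatPattern {n = n} p) (λ i → p≤b _)

pattern10-separated : Separated pattern10
pattern10-separated = from-yes (separated? pattern10)

pattern14-separated : Separated pattern14
pattern14-separated = from-yes (separated? pattern14)

pattern10-≤13 : ∀ j → lookup pattern10 j ≤ 13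
pattern10-≤13 = from-yes (all? λ j → lookup pattern10 j ≤? 13)

pattern14-≤13 : ∀ j → lookup pattern14 j ≤ 13
pattern14-≤13 = from-yes (all? λ j → lookup pattern14 j ≤? 13)

mainTheorem3 : (k n : ℕ) → 1 ≤ k → (n ≡ 10 * k ⊎ n ≡ 14 * k) →
    λ321≤ (Circulant n (S1-3 n)) 13
    × (n ≡ 10 * k → IsL321 (Circulant n (S1-3 n)) (repeatPattern pattern10))
    × (n ≡ 14 * k → IsL321 (Circulant n (S1-3 n)) (repeatPattern pattern14))
mainTheorem3 k n _ n≡ =
    [ (λ n≡10k → repeatPattern-λ321≤ pattern10 3≤10 pattern10-separated pattern10-≤13 (period∣ n≡10k))
    , (λ n≡14k → repeatPattern-λ321≤ pattern14 3≤14 pattern14-separated pattern14-≤13 (period∣ n≡14k))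
    ]′ n≡
  , (λ n≡10k → repeatPattern-isL321 pattern10 3≤10 pattern10-separated (period∣ n≡10k))
  , (λ n≡14k → repeatPattern-isL321 pattern14 3≤14 pattern14-separated (period∣ n≡14k))
  where
  period∣ : ∀ {m} → n ≡ m * k → m ∣ n
  period∣ n≡mk = divides k (trans n≡mk (*-comm _ k))

  3≤10 : 3 ≤ 10
  3≤10 = from-yes (3 ≤? 10)

  3≤14 : 3 ≤ 14
  3≤14 = from-yes (3 ≤? 14)
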